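{- For every real number $\alpha \ge 1$ there exists an instance $(G,\mathcal{S})$ of \textsc{MinSum Retrieval} such that: (i) $G$ is a directed path; (ii) $G$ has a single weight function, namely $s_e = r_e$ for every edge $e$; (iii) the triangle inequality holds; and the solution returned by the algorithm \textsf{LMG} on $(G,\mathcal{S})$ has total retrieval cost strictly larger than $\alpha$ times the optimal total retrieval cost of \textsc{MinSum Retrieval} on $(G,\mathcal{S})$ (this optimum being positive). In other words, \textsf{LMG} has no bounded approximation factor for \textsc{MinSum Retrieval}, even under assumptions (i)–(iii).
   Context: A version graph is a directed graph $G=(V,E)$ in which every vertex (version) $v$ has a materialization (storage) cost $s_v\in\mathbb{N}$ and every edge (delta) $e=(u,v)$ has a storage cost $s_e\in\mathbb{N}$ and a retrieval cost $r_e\in\mathbb{N}$. A solution consists of a set $M\subseteq V$ of materialized vertices and a set $F\subseteq E$ of stored edges such that every vertex is reachable from some vertex of $M$ by a directed path (possibly of length $0$) using only edges of $F$. Its storage cost is $\sum_{v\in M}s_v+\sum_{e\in F}s_e$; the retrieval cost $R(v)$ of a vertex $v$ is the minimum, over such paths from a vertex of $M$ to $v$ with all edges in $F$, of the sum of $r_e$ along the path (so $R(v)=0$ if $v\in M$). \textsc{MinSum Retrieval}: given $G$ and a storage bound $\mathcal{S}$, find a solution of storage cost at most $\mathcal{S}$ minimizing $\sum_{v\in V}R(v)$. The triangle inequality means: $r_{u,v}\le r_{u,w}+r_{w,v}$ and $s_{u,v}\le s_{u,w}+s_{w,v}$ whenever the three edges exist, and $s_u+s_{u,v}\ge s_v$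 for every edge $(u,v)$. The algorithm \textsf{LMG} (Local Move Greedy): form $G_{aux}$ by adding a new vertex $v_{aux}$ and, for each $v\in V$, an edge $(v_{aux},v)$ with retrieval cost $0$ and storage cost $s_v$. Arborescences $T$ of $G_{aux}$ rooted at $v_{aux}$ correspond to solutions (edge $(v_{aux},v)\in T$ means $v$ is materialized; other edges of $T$ are stored); $S(T)$ is the sum of storage costs of edges of $T$, $R_T(v)$ the sum of retrieval costs on the $v_{aux}$–$v$ path in $T$, and $P(v)$ the parent of $v$ in $T$. Start with $T$ a minimum-storage arborescence of $G_{aux}$ rooted at $v_{aux}$. While $S(T)<\mathcal{S}$: for every not-yet-materialized vertex $v$ with $S(T)+s_v-s_{P(v),v}\le\mathcal{S}$, let $T'$ be $T$ with $(P(v),v)$ replaced by $(v_{aux},v)$ and compute the ratio $\rho(v)=\big(\sum_w R_T(w)-\sum_w R_{T'}(w)\big)/(s_v-s_{P(v),v})$; replace $T$ by $T'$ for a vertex $v$ of maximum positive ratio (stop if there is no such vertex or all vertices are materialized). Output $T$.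
   Formalization: The parameter α ranges over the rationals with α ≥ 1 rather than over all real numbers α ≥ 1. -}

module Defs where

open import Data.Nat as ℕ using (ℕ; zero; suc; _+_; _≤_; _<_)
open import Data.Integer as ℤ using (ℤ; +_; _-_)
open import Data.Bool using (Bool; true; false; if_then_else_)
open import Data.Fin using (Fin; zero; suc; inject₁; _≟_)
open import Data.Maybe using (Maybe; just; nothing; is-nothing)
import Data.Maybe.Properties as MaybeP
open import Data.Product using (Σ; ∃; _×_; _,_)
open import Relation.Nullary using (does)
open import Relation.Binary.PropositionalEquality using (_≡_)
open import Relation.Binary.Construct.Closure.ReflexiveTransitive using (Star)

∑ : ∀ {n} → (Fin n → ℕ) → ℕ
∑ {zero}  f = 0
∑ {suc n} f = f zero + ∑ (λ i → f (suc i))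

record VersionGraph : Set where
  field
    n    : ℕ
    m    : ℕ
    vs   : Fin n → ℕ        -- materialization cost s_v
    src  : Fin m → Fin n
    tgt  : Fin m → Fin n
    es   : Fin m → ℕ        -- storage cost s_e
    er   : Fin m → ℕ        -- retrieval cost r_e

open VersionGraph public

pathGraph : (k : ℕ) → (Fin (suc k) → ℕ) → (Fin k → ℕ) → (Fin k → ℕ) → VersionGraph
pathGraph k vc ws wr = record
  { n = suc k ; m = k ; vs = vc ; src = inject₁ ; tgt = suc ; es = ws ; er = wr }

IsDirectedPath : VersionGraph → Set
IsDirectedPath G = ∃ λ k → ∃ λ vc → ∃ λ ws → ∃ λ wr → G ≡ pathGraph k vc ws wr

SingleWeight : VersionGraph → Set
SingleWeight G = ∀ e → es G e ≡ er G e

TriangleInequality : VersionGraph → Set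
TriangleInequality G =
  (∀ (e₁ e₂ e₃ : Fin (m G)) → src G e₁ ≡ src G e₃ → tgt G e₁ ≡ src G e₂ → tgt G e₂ ≡ tgt G e₃ →
     (er G e₃ ≤ er G e₁ + er G e₂) × (es G e₃ ≤ es G e₁ + es G e₂))
  × (∀ e → vs G (tgt G e) ≤ vs G (src G e) + es G e)

record Solution (G : VersionGraph) : Set where
  field
    M : Fin (n G) → Bool    -- materialized vertices
    F : Fin (m G) → Bool    -- stored edges

open Solution public

storage : ∀ {G} → Solution G → ℕ
storage {G} σ = ∑ (λ v → if M σ v then vs G v else 0) + ∑ (λ e → if F σ e then es G e else 0)

data RPath {G : VersionGraph} (σ : Solution G) : Fin (n G) → ℕ → Set where
  rp-mat  : ∀ {v} → M σ v ≡ true → RPath σ v 0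
  rp-edge : ∀ {e c} → F σ e ≡ true → RPath σ (src G e) c → RPath σ (tgt G e) (c + er G e)

Feasible : ∀ {G} → Solution G → Set
Feasible {G} σ = ∀ (v : Fin (n G)) → ∃ λ c → RPath σ v c

Retrieval : ∀ {G} → Solution G → Fin (n G) → ℕ → Set
Retrieval σ v c = RPath σ v c × (∀ c' → RPath σ v c' → c ≤ c')

TotalRetrieval : ∀ {G} → Solution G → ℕ → Set
TotalRetrieval {G} σ C = Σ (Fin (n G) → ℕ) λ R → (∀ v → Retrieval σ v (R v)) × ∑ R ≡ C

IsOptimum : (G : VersionGraph) → ℕ → ℕ → Set
IsOptimum G Sb opt =
  (∃ λ (σ : Solution G) → storage σ ≤ Sb × Feasible σ × TotalRetrieval σ opt)
  × (∀ (σ : Solution G) C → storage σ ≤ Sb → Feasible σ → TotalRetrieval σ C → opt ≤ C)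

-- Arborescences of G_aux rooted at v_aux, as parent maps:
-- T v = nothing  means edge (v_aux , v) ∈ T (v materialized),
-- T v = just e   means e ∈ T is the edge entering v.

record Tree (G : VersionGraph) : Set where
  constructor tree
  field
    parent : Fin (n G) → Maybe (Fin (m G))

open Tree public

data RT {G : VersionGraph} (T : Tree G) : Fin (n G) → ℕ → Set where
  rt-root : ∀ {v} → parent T v ≡ nothing → RT T v 0
  rt-edge : ∀ {v e c} → parent T v ≡ just e → RT T (src G e) c → RT T v (c + er G e)

IsArborescence : ∀ {G} → Tree G → Set
IsArborescence {G} T =
  (∀ v e → parent T v ≡ just e → tgt G e ≡ v) × (∀ v → ∃ λ c → RT T v c)

treeStorage : ∀ {G} → Tree G → ℕ
treeStorage {G} T = ∑ λ v → edgeCost v (parent T v)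
  where
  edgeCost : Fin (n G) → Maybe (Fin (m G)) → ℕ
  edgeCost v nothing  = vs G v
  edgeCost v (just e) = es G e

TotalRT : ∀ {G} → Tree G → ℕ → Set
TotalRT {G} T C = Σ (Fin (n G) → ℕ) λ R → (∀ v → RT T v (R v)) × ∑ R ≡ C

IsMinStorageArborescence : ∀ {G} → Tree G → Set
IsMinStorageArborescence {G} T =
  IsArborescence T × (∀ (T' : Tree G) → IsArborescence T' → treeStorage T ≤ treeStorage T')

materialize : ∀ {G} → Tree G → Fin (n G) → Tree G
materialize T v = tree λ w → if does (w ≟ v) then nothing else parent T w

Δs : (G : VersionGraph) → Fin (n G) → Fin (m G) → ℤ
Δs G v e = + vs G v - + es G e

-- v is a candidate of LMG in T (not materialized, fits the budget, ratio defined)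
Candidate : (G : VersionGraph) → ℕ → Tree G → Fin (n G) → Fin (m G) → Set
Candidate G Sb T v e =
  parent T v ≡ just e × ℤ.+ 0 ℤ.< Δs G v e × (+ treeStorage T) ℤ.+ Δs G v e ℤ.≤ + Sb

-- One iteration of LMG: materialize a candidate v of maximum positive ratio
-- ρ(v) = (∑R_T - ∑R_{T'}) / (s_v - s_{P(v),v}).
data LMGStep (G : VersionGraph) (Sb : ℕ) (T : Tree G) : Tree G → Set where
  step : ∀ v e C Cv →
    treeStorage T < Sb →
    Candidate G Sb T v e →
    TotalRT T C →
    TotalRT (materialize T v) Cv →
    ℤ.+ 0 ℤ.< (+ C - + Cv) →
    (∀ w e' Cw → Candidate G Sb T w e' → TotalRT (materialize T w) Cw →
       (+ C - + Cw) ℤ.* Δs G v e ℤ.≤ (+ C - + Cv) ℤ.* Δs G w e') →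
    LMGStep G Sb T (materialize T v)

-- T is a possible output of LMG on (G, Sb) (any tie-breaking, any initial
-- minimum-storage arborescence).
LMGOutput : (G : VersionGraph) → ℕ → Tree G → Set
LMGOutput G Sb T =
  ∃ λ T₀ → IsMinStorageArborescence T₀ × Star (LMGStep G Sb) T₀ T
    × (∀ T' → LMGStep G Sb T T' → Data.Empty.⊥)
  where import Data.Empty

treeSolution : ∀ {G} → Tree G → Solution G
treeSolution {G} T = record
  { M = λ v → is-nothing (parent T v)
  ; F = λ e → does (MaybeP.≡-dec _≟_ (parent T (tgt G e)) (just e)) }

{-# OPTIONS --safe #-}

-- Take the path v₀ → v₁ → v₂ with delta costs k + 1 and 1, materialization costs 2, k + 3, 2
-- and budget k + 6.  The minimum-storage arborescence stores both deltas (storage k + 4).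
-- Materializing v₂ saves k + 2 retrieval for one unit of storage, materializing v₁ saves
-- 2k + 2 for two units, so LMG materializes v₂; then v₁ no longer fits and LMG stops with
-- total retrieval k + 1.  Materializing v₀ and v₁ costs exactly k + 6 and leaves total
-- retrieval 1, which is optimal since the budget cannot materialize all three versions.
-- With k = ∣numerator α∣ we have α < k + 1, whatever the rational α is.
module Submission where

open import Defs
open import Data.Nat using (ℕ)
open import Data.Integer using (+_)
open import Data.Rational using (ℚ; 1ℚ; _≤_; _<_; _*_; _/_)
open import Data.Product using (∃; _×_)

open import Data.Empty using (⊥; ⊥-elim)
open import Data.Bool using (true; false; if_then_else_)
import Data.Bool.Properties as Bool
open import Data.Fin using (Fin; zero; suc; inject₁; toℕ)
import Data.Fin.Properties as Fin
open import Data.Integer as ℤ using (-[1+_])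
import Data.Integer.Properties as ℤ
open import Data.Maybe using (just; nothing; is-nothing)
open import Data.Maybe.Properties using (just-injective)
open import Data.Nat as ℕ using (zero; suc; z≤n; z<s)
import Data.Nat.Properties as ℕ
import Data.Nat.Coprimality as Coprime
open import Data.Nat.Tactic.RingSolver using (solve)
open import Data.List using (_∷_; [])
open import Data.Product using (_,_; proj₁; proj₂)
open import Data.Rational using (mkℚ; ↥_; *<*)
open import Data.Rational.Properties using (normalize-coprime; *-identityʳ)
open import Data.Sum using (_⊎_; inj₁; inj₂)
open import Function using (id; _∘′_)
open import Relation.Binary.Construct.Closure.ReflexiveTransitive using (Star; ε; _◅_; fold)
open import Relation.Binary.PropositionalEquality
open import Relation.Nullary using (¬_; contradiction)

∑-cong : ∀ {n} {f g : Fin n → ℕ} → (∀ i → f i ≡ g i) → ∑ f ≡ ∑ g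
∑-cong {zero}  f≡g = refl
∑-cong {suc n} f≡g = cong₂ ℕ._+_ (f≡g zero) (∑-cong (λ i → f≡g (suc i)))

≤-∑ : ∀ {n} (f : Fin n → ℕ) i → f i ℕ.≤ ∑ f
≤-∑ f zero    = ℕ.m≤m+n (f zero) _
≤-∑ f (suc i) = ℕ.≤-trans (≤-∑ (λ j → f (suc j)) i) (ℕ.m≤n+m _ (f zero))

+[m+n]-[+m]≡+n : ∀ m n → + (m ℕ.+ n) ℤ.- + m ≡ + n
+[m+n]-[+m]≡+n m n = begin
  + (m ℕ.+ n) ℤ.- + m      ≡⟨ ℤ.[+m]-[+n]≡m⊖n (m ℕ.+ n) m ⟩
  (m ℕ.+ n) ℤ.⊖ m          ≡⟨ ℤ.⊖-≥ (ℕ.m≤m+n m n) ⟩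
  + (m ℕ.+ n ℕ.∸ m)        ≡⟨ cong +_ (ℕ.m+n∸m≡n m n) ⟩
  + n                      ∎
  where open ≡-Reasoning

i≤+∣i∣ : ∀ i → i ℤ.≤ + ℤ.∣ i ∣
i≤+∣i∣ (+ n)      = ℤ.≤-refl
i≤+∣i∣ -[1+ n ]   = ℤ.-≤+

∣↥p∣<m⇒p<m/1 : ∀ p {m} → ℤ.∣ ↥ p ∣ ℕ.< m → p < + m / 1
∣↥p∣<m⇒p<m/1 p@(mkℚ i d _) {m} ∣i∣<m =
  subst (p <_) (sym (normalize-coprime (Coprime.sym (Coprime.1-coprimeTo m)))) (*<* (begin-strict
    i ℤ.* + 1            ≡⟨ ℤ.*-identityʳ i ⟩
    i                    ≤⟨ i≤+∣i∣ i ⟩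
    + ℤ.∣ i ∣            <⟨ ℤ.+<+ ∣i∣<m ⟩
    + m                  ≤⟨ ℤ.+≤+ (ℕ.m≤m*n m (suc d)) ⟩
    + (m ℕ.* suc d)      ≡⟨ ℤ.pos-* m (suc d) ⟩
    + m ℤ.* + suc d      ∎))
  where open ℤ.≤-Reasoning

module _ {G : VersionGraph} where

  RT-functional : ∀ {T : Tree G} {v c c′} → RT T v c → RT T v c′ → c ≡ c′
  RT-functional (rt-root _)  (rt-root _)   = refl
  RT-functional (rt-root p)  (rt-edge q _) = contradiction (trans (sym p) q) λ ()
  RT-functional (rt-edge p _) (rt-root q)  = contradiction (trans (sym q) p) λ ()
  RT-functional (rt-edge p r) (rt-edge q r′) with just-injective (trans (sym p) q)
  ... | refl = cong (ℕ._+ er G _) (RT-functional r r′)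

  TotalRT-functional : ∀ {T : Tree G} {C C′} → TotalRT T C → TotalRT T C′ → C ≡ C′
  TotalRT-functional (_ , rt , refl) (_ , rt′ , refl) =
    ∑-cong λ v → RT-functional (rt v) (rt′ v)

  unmaterialized-RPath-edge : ∀ {σ : Solution G} {v c} → M σ v ≡ false → RPath σ v c →
    ∃ λ e → tgt G e ≡ v × er G e ℕ.≤ c
  unmaterialized-RPath-edge m≡false (rp-mat m≡true) =
    contradiction (trans (sym m≡false) m≡true) λ ()
  unmaterialized-RPath-edge _ (rp-edge {e} {c} _ _)  = e , refl , ℕ.m≤n+m (er G e) c

  unmaterialized-RPath-positive : ∀ {σ : Solution G} {v c} → (∀ e → 0 ℕ.< er G e) →
    M σ v ≡ false → RPath σ v c → 0 ℕ.< c
  unmaterialized-RPath-positive er>0 m≡false path =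
    let e , _ , e≤c = unmaterialized-RPath-edge m≡false path in ℕ.<-≤-trans (er>0 e) e≤c

  all-materialized⇒∑vs≤storage : ∀ {σ : Solution G} → (∀ v → M σ v ≡ true) →
    ∑ (vs G) ℕ.≤ storage σ
  all-materialized⇒∑vs≤storage all =
    ℕ.≤-trans (ℕ.≤-reflexive (∑-cong λ v →
                cong (λ b → if b then vs G v else 0) (sym (all v))))
              (ℕ.m≤m+n _ _)

  TotalRetrieval⇒Feasible : ∀ {σ : Solution G} {C} → TotalRetrieval σ C → Feasible σ
  TotalRetrieval⇒Feasible (R , retrieval , _) v = R v , proj₁ (retrieval v)

  TotalRetrieval-positive : ∀ {σ : Solution G} {Sb C} → (∀ e → 0 ℕ.< er G e) →
    Sb ℕ.< ∑ (vs G) → storage σ ℕ.≤ Sb → TotalRetrieval σ C → 0 ℕ.< C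
  TotalRetrieval-positive {σ} er>0 Sb<∑vs storage≤Sb (R , retrieval , refl) =
    ℕ.<-≤-trans
      (unmaterialized-RPath-positive er>0 (Bool.¬-not v≢true) (proj₁ (retrieval v)))
      (≤-∑ R v)
    where
    not-all-materialized : ¬ (∀ v → M σ v ≡ true)
    not-all-materialized all =
      ℕ.<⇒≱ Sb<∑vs (ℕ.≤-trans (all-materialized⇒∑vs≤storage all) storage≤Sb)
    some-unmaterialized : ∃ λ v → M σ v ≢ true
    some-unmaterialized =
      Fin.¬∀⟶∃¬ _ (λ v → M σ v ≡ true) (λ v → M σ v Bool.≟ true)
                   not-all-materialized
    v = proj₁ some-unmaterialized
    v≢true = proj₂ some-unmaterialized

  materialized⇒¬Candidate : ∀ {Sb} (T : Tree G) {v e} → parent T v ≡ nothing →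
    ¬ Candidate G Sb T v e
  materialized⇒¬Candidate _ p≡nothing (p≡just , _) =
    contradiction (trans (sym p≡nothing) p≡just) λ ()

  Candidate-edge : ∀ {Sb} (T : Tree G) {v e e′} → parent T v ≡ just e →
    Candidate G Sb T v e′ → e′ ≡ e
  Candidate-edge _ p≡e (p≡e′ , _) = just-injective (trans (sym p≡e′) p≡e)

module _ {k vc ws wr} {T : Tree (pathGraph k vc ws wr)} (arb : IsArborescence T) where

  pathGraph-root : parent T zero ≡ nothing
  pathGraph-root with parent T zero in p
  ... | nothing = refl
  ... | just e  = contradiction (sym (proj₁ arb zero e p)) Fin.0≢1+n

  pathGraph-parent : ∀ i → parent T (suc i) ≡ nothing ⊎ parent T (suc i) ≡ just i
  pathGraph-parent i with parent T (suc i) in p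
  ... | nothing = inj₁ refl
  ... | just e  = inj₂ (cong just (Fin.suc-injective (proj₁ arb (suc i) e p)))

pathGraph-triangle-free : ∀ {k} (e₁ e₂ e₃ : Fin k) → inject₁ e₁ ≡ inject₁ e₃ →
  suc e₁ ≡ inject₁ e₂ → suc e₂ ≡ suc e₃ → ⊥
pathGraph-triangle-free e₁ e₂ e₃ src≡ tgt≡src tgt≡
  with Fin.inject₁-injective src≡ | Fin.suc-injective tgt≡
... | refl | refl = ℕ.1+n≢n (trans (cong toℕ tgt≡src) (Fin.toℕ-inject₁ e₁))

module Gadget (k : ℕ) where

  v₀ v₁ v₂ : Fin 3
  v₀ = zero
  v₁ = suc zero
  v₂ = suc (suc zero)

  e₀₁ e₁₂ : Fin 2
  e₀₁ = zero
  e₁₂ = suc zero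

  vertexCost : Fin 3 → ℕ
  vertexCost zero             = 2
  vertexCost (suc zero)       = 2 ℕ.+ suc k
  vertexCost (suc (suc zero)) = 2

  deltaCost : Fin 2 → ℕ
  deltaCost zero       = suc k
  deltaCost (suc zero) = 1

  G : VersionGraph
  G = pathGraph 2 vertexCost deltaCost deltaCost

  budget : ℕ
  budget = 6 ℕ.+ k

  deltaCost-positive : ∀ e → 0 ℕ.< er G e
  deltaCost-positive zero       = z<s
  deltaCost-positive (suc zero) = z<s

  triangle : TriangleInequality G
  triangle = (λ e₁ e₂ e₃ p q r → ⊥-elim (pathGraph-triangle-free e₁ e₂ e₃ p q r)) ,
             materialization-triangle
    where
    materialization-triangle : ∀ e → vs G (tgt G e) ℕ.≤ vs G (src G e) ℕ.+ es G e
    materialization-triangle zero       = ℕ.≤-refl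
    materialization-triangle (suc zero) = ℕ.s≤s (ℕ.s≤s z≤n)

  optimal : Solution G
  optimal = record
    { M = λ { zero → true ; (suc zero) → true ; (suc (suc zero)) → false }
    ; F = λ { zero → false ; (suc zero) → true } }

  optimal-storage : storage optimal ℕ.≤ budget
  optimal-storage = ℕ.+-monoʳ-≤ 5 (ℕ.≤-reflexive (begin
    k ℕ.+ 0 ℕ.+ 1  ≡⟨ cong (ℕ._+ 1) (ℕ.+-identityʳ k) ⟩
    k ℕ.+ 1        ≡⟨ ℕ.+-comm k 1 ⟩
    suc k          ∎))
    where open ≡-Reasoning

  optimal-total : TotalRetrieval optimal 1
  optimal-total = R , retrieval , refl
    where
    R : Fin 3 → ℕ
    R zero             = 0
    R (suc zero)       = 0
    R (suc (suc zero)) = 1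
    retrieval : ∀ v → Retrieval optimal v (R v)
    retrieval zero             = rp-mat refl , λ _ _ → z≤n
    retrieval (suc zero)       = rp-mat refl , λ _ _ → z≤n
    retrieval (suc (suc zero)) = rp-edge {e = e₁₂} refl (rp-mat refl) ,
                                 λ _ → unmaterialized-RPath-positive deltaCost-positive refl

  optimum : IsOptimum G budget 1
  optimum =
    (optimal , optimal-storage , TotalRetrieval⇒Feasible optimal-total , optimal-total) ,
    λ _ _ storage≤budget _ →
      TotalRetrieval-positive deltaCost-positive budget<∑vs storage≤budget
    where
    budget<∑vs : budget ℕ.< ∑ (vs G)
    budget<∑vs = ℕ.+-monoʳ-≤ 5 (ℕ.≤-reflexive (ℕ.+-comm 2 k))

  record IsChain (T : Tree G) : Set where
    constructor is-chain
    field
      v₀-root  : parent T v₀ ≡ nothing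
      v₁-delta : parent T v₁ ≡ just e₀₁
      v₂-delta : parent T v₂ ≡ just e₁₂

  record IsLMGResult (T : Tree G) : Set where
    constructor is-LMG-result
    field
      v₀-root  : parent T v₀ ≡ nothing
      v₁-delta : parent T v₁ ≡ just e₀₁
      v₂-root  : parent T v₂ ≡ nothing

  chainTree : Tree G
  chainTree = tree λ
    { zero             → nothing
    ; (suc zero)       → just e₀₁
    ; (suc (suc zero)) → just e₁₂
    }

  chainTree-isChain : IsChain chainTree
  chainTree-isChain = is-chain refl refl refl

  chain-storage : ∀ {T} → IsChain T → treeStorage T ≡ 4 ℕ.+ k
  chain-storage (is-chain p₀ p₁ p₂) rewrite p₀ | p₁ | p₂ =
    cong (3 ℕ.+_) (ℕ.+-comm k 1)

  LMGResult-storage : ∀ {T} → IsLMGResult T → treeStorage T ≡ 5 ℕ.+ k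
  LMGResult-storage (is-LMG-result p₀ p₁ p₂) rewrite p₀ | p₁ | p₂ =
    cong (3 ℕ.+_) (ℕ.+-comm k 2)

  chain-or-costlier : ∀ {T} → IsArborescence T → IsChain T ⊎ 5 ℕ.+ k ℕ.≤ treeStorage T
  chain-or-costlier {T} arb
    with pathGraph-root arb | pathGraph-parent arb e₀₁ | pathGraph-parent arb e₁₂
  ... | p₀ | inj₂ p₁ | inj₂ p₂ = inj₁ (is-chain p₀ p₁ p₂)
  ... | p₀ | inj₂ p₁ | inj₁ p₂ =
    inj₂ (ℕ.≤-reflexive (sym (LMGResult-storage {T} (is-LMG-result p₀ p₁ p₂))))
  ... | p₀ | inj₁ p₁ | inj₂ p₂ rewrite p₀ | p₁ | p₂ =
    inj₂ (ℕ.+-monoʳ-≤ 5 (ℕ.m≤m+n k 1))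
  ... | p₀ | inj₁ p₁ | inj₁ p₂ rewrite p₀ | p₁ | p₂ =
    inj₂ (ℕ.+-monoʳ-≤ 5 (ℕ.m≤m+n k 2))

  chainRetrieval : ℕ
  chainRetrieval = suc k ℕ.+ (suc k ℕ.+ 1)

  chain-total : ∀ {T} → IsChain T → TotalRT T chainRetrieval
  chain-total {T} (is-chain p₀ p₁ p₂) =
    R , rt , cong (suc k ℕ.+_) (ℕ.+-identityʳ (suc k ℕ.+ 1))
    where
    R : Fin 3 → ℕ
    R zero             = 0
    R (suc zero)       = suc k
    R (suc (suc zero)) = suc k ℕ.+ 1
    rt : ∀ v → RT T v (R v)
    rt zero             = rt-root p₀
    rt (suc zero)       = rt-edge p₁ (rt-root p₀)
    rt (suc (suc zero)) = rt-edge p₂ (rt-edge p₁ (rt-root p₀))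

  v₁-materialized-total : ∀ {T} → IsChain T → TotalRT (materialize T v₁) 1
  v₁-materialized-total {T} (is-chain p₀ _ p₂) = R , rt , refl
    where
    R : Fin 3 → ℕ
    R zero             = 0
    R (suc zero)       = 0
    R (suc (suc zero)) = 1
    rt : ∀ v → RT (materialize T v₁) v (R v)
    rt zero             = rt-root p₀
    rt (suc zero)       = rt-root refl
    rt (suc (suc zero)) = rt-edge p₂ (rt-root refl)

  v₂-materialized-total : ∀ {T} → IsChain T → TotalRT (materialize T v₂) (suc k)
  v₂-materialized-total {T} (is-chain p₀ p₁ _) = R , rt , cong suc (ℕ.+-identityʳ k)
    where
    R : Fin 3 → ℕ
    R zero             = 0
    R (suc zero)       = suc k
    R (suc (suc zero)) = 0
    rt : ∀ v → RT (materialize T v₂) v (R v)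
    rt zero             = rt-root p₀
    rt (suc zero)       = rt-edge p₁ (rt-root p₀)
    rt (suc (suc zero)) = rt-root refl

  gain₁ gain₂ : ℕ
  gain₁ = k ℕ.+ (suc k ℕ.+ 1)
  gain₂ = suc k ℕ.+ 1

  chain-gain₁ : ∀ {T C C′} → IsChain T →
    TotalRT T C → TotalRT (materialize T v₁) C′ → + C ℤ.- + C′ ≡ + gain₁
  chain-gain₁ chain total total′
    rewrite TotalRT-functional total (chain-total chain)
          | TotalRT-functional total′ (v₁-materialized-total chain)
    = +[m+n]-[+m]≡+n 1 gain₁

  chain-gain₂ : ∀ {T C C′} → IsChain T →
    TotalRT T C → TotalRT (materialize T v₂) C′ → + C ℤ.- + C′ ≡ + gain₂
  chain-gain₂ chain total total′
    rewrite TotalRT-functional total (chain-total chain)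
          | TotalRT-functional total′ (v₂-materialized-total chain)
    = +[m+n]-[+m]≡+n (suc k) gain₂

  Δs₁ : Δs G v₁ e₀₁ ≡ + 2
  Δs₁ = trans (cong (λ s → + s ℤ.- + suc k) (ℕ.+-comm 2 (suc k)))
              (+[m+n]-[+m]≡+n (suc k) 2)

  -- The ratios of v₁ and v₂, cross-multiplied: gain₁ / 2 = k + 1 < k + 2 = gain₂ / 1.
  ratio₁<ratio₂ : + gain₁ ℤ.* + 1 ℤ.< + gain₂ ℤ.* + 2
  ratio₁<ratio₂ = subst₂ ℤ._<_ (ℤ.pos-* gain₁ 1) (ℤ.pos-* gain₂ 2)
    (ℤ.+<+ (subst (gain₁ ℕ.* 1 ℕ.<_) (sym gain₂*2≡2+gain₁*1) (ℕ.m<n+m _ z<s)))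
    where
    gain₂*2≡2+gain₁*1 : (suc k ℕ.+ 1) ℕ.* 2 ≡ 2 ℕ.+ (k ℕ.+ (suc k ℕ.+ 1)) ℕ.* 1
    gain₂*2≡2+gain₁*1 = solve (k ∷ [])

  chainTree-minimal : IsMinStorageArborescence chainTree
  chainTree-minimal = (tgt≡ , λ v → _ , proj₁ (proj₂ (chain-total chainTree-isChain)) v) ,
                      minimal
    where
    tgt≡ : ∀ v e → parent chainTree v ≡ just e → tgt G e ≡ v
    tgt≡ (suc zero)       zero       refl = refl
    tgt≡ (suc (suc zero)) (suc zero) refl = refl
    minimal : ∀ T → IsArborescence T → treeStorage chainTree ℕ.≤ treeStorage T
    minimal T arb with chain-or-costlier arb
    ... | inj₁ chain    = ℕ.≤-reflexive (trans (chain-storage chainTree-isChain)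
                                               (sym (chain-storage chain)))
    ... | inj₂ costlier = ℕ.≤-trans (ℕ.≤-reflexive (chain-storage chainTree-isChain))
                                    (ℕ.≤-trans (ℕ.n≤1+n _) costlier)

  minimal⇒chain : ∀ {T} → IsMinStorageArborescence T → IsChain T
  minimal⇒chain {T} (arb , minimal) with chain-or-costlier arb
  ... | inj₁ chain    = chain
  ... | inj₂ costlier = ⊥-elim (ℕ.n≮n (4 ℕ.+ k) (begin
    5 ℕ.+ k                   ≤⟨ costlier ⟩
    treeStorage T             ≤⟨ minimal chainTree (proj₁ chainTree-minimal) ⟩
    treeStorage chainTree     ≡⟨ chain-storage chainTree-isChain ⟩
    4 ℕ.+ k                   ∎))
    where open ℕ.≤-Reasoning

  chain-below-budget : ∀ {T} → IsChain T → treeStorage T ℕ.< budget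
  chain-below-budget chain =
    subst (ℕ._< budget) (sym (chain-storage chain)) (ℕ.+-monoʳ-≤ 5 (ℕ.n≤1+n k))

  chain-candidate₂ : ∀ {T} → IsChain T → Candidate G budget T v₂ e₁₂
  chain-candidate₂ chain@(is-chain _ _ p₂) =
    p₂ , ℤ.+<+ z<s ,
    subst (λ s → + s ℤ.+ + 1 ℤ.≤ + budget) (sym (chain-storage chain))
      (ℤ.+≤+ (ℕ.+-monoʳ-≤ 4 (ℕ.≤-trans (ℕ.≤-reflexive (ℕ.+-comm k 1))
                                        (ℕ.n≤1+n _))))

  chain-step : ∀ {T T′} → IsChain T → LMGStep G budget T T′ → IsLMGResult T′
  chain-step {T} (is-chain p₀ _ _) (step zero _ _ _ _ candidate _ _ _ _) =
    contradiction candidate (materialized⇒¬Candidate T p₀)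
  chain-step {T} (is-chain p₀ p₁ _) (step (suc (suc zero)) _ _ _ _ _ _ _ _ _) =
    is-LMG-result p₀ p₁ refl
  chain-step {T} chain@(is-chain _ p₁ _) (step (suc zero) _ _ _ _ candidate total total₁ _ best)
    with Candidate-edge T p₁ candidate
  ... | refl = contradiction
    (subst₂ ℤ._≤_ (cong₂ ℤ._*_ (chain-gain₂ chain total total₂) Δs₁)
                  (cong (ℤ._* + 1) (chain-gain₁ chain total total₁))
                  (best v₂ e₁₂ _ (chain-candidate₂ chain) total₂))
    (ℤ.<⇒≱ ratio₁<ratio₂)
    where total₂ = v₂-materialized-total chain

  chain-first-step : ∀ {T} → IsChain T → LMGStep G budget T (materialize T v₂)
  chain-first-step {T} chain@(is-chain p₀ p₁ p₂) =
    step v₂ e₁₂ chainRetrieval (suc k) (chain-below-budget chain) (chain-candidate₂ chain)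
      (chain-total chain) (v₂-materialized-total chain)
      (subst (ℤ.+ 0 ℤ.<_) (sym (gain₂-at (v₂-materialized-total chain))) (ℤ.+<+ z<s)) best
    where
    gain₂-at : ∀ {C} → TotalRT (materialize T v₂) C →
      + chainRetrieval ℤ.- + C ≡ + gain₂
    gain₂-at = chain-gain₂ chain (chain-total chain)
    best : ∀ w e C → Candidate G budget T w e → TotalRT (materialize T w) C →
      (+ chainRetrieval ℤ.- + C) ℤ.* Δs G v₂ e₁₂ ℤ.≤
      (+ chainRetrieval ℤ.- + suc k) ℤ.* Δs G w e
    best zero _ _ candidate _ = contradiction candidate (materialized⇒¬Candidate T p₀)
    best (suc zero) _ _ candidate total₁ with Candidate-edge T p₁ candidate
    ... | refl =
      subst₂ ℤ._≤_ (sym (cong (ℤ._* + 1)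
                              (chain-gain₁ chain (chain-total chain) total₁)))
                   (sym (cong₂ ℤ._*_ (gain₂-at (v₂-materialized-total chain)) Δs₁))
                   (ℤ.<⇒≤ ratio₁<ratio₂)
    best (suc (suc zero)) _ _ candidate total₂ with Candidate-edge T p₂ candidate
    ... | refl = ℤ.≤-reflexive (cong (ℤ._* + 1)
                   (trans (gain₂-at total₂) (sym (gain₂-at (v₂-materialized-total chain)))))

  LMGResult-stuck : ∀ {T T′} → IsLMGResult T → ¬ LMGStep G budget T T′
  LMGResult-stuck {T} (is-LMG-result p₀ _ _) (step zero _ _ _ _ candidate _ _ _ _) =
    materialized⇒¬Candidate T p₀ candidate
  LMGResult-stuck {T} (is-LMG-result _ _ p₂) (step (suc (suc zero)) _ _ _ _ candidate _ _ _ _) =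
    materialized⇒¬Candidate T p₂ candidate
  LMGResult-stuck {T} result@(is-LMG-result _ p₁ _) (step (suc zero) _ _ _ _ candidate _ _ _ _)
    with Candidate-edge T p₁ candidate
  ... | refl = ℕ.n≮n budget (subst (ℕ._≤ budget) (cong (5 ℕ.+_) (ℕ.+-comm k 2))
                 (ℤ.drop‿+≤+ (subst₂ (λ s δ → + s ℤ.+ δ ℤ.≤ + budget)
                                     (LMGResult-storage result) Δs₁ fits)))
    where fits = proj₂ (proj₂ candidate)

  LMG-output : LMGOutput G budget (materialize chainTree v₂)
  LMG-output = chainTree , chainTree-minimal , chain-first-step chainTree-isChain ◅ ε ,
               λ _ → LMGResult-stuck (is-LMG-result refl refl refl)

  LMG-run : ∀ {T T′} → IsChain T → Star (LMGStep G budget) T T′ →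
    IsChain T′ ⊎ IsLMGResult T′
  LMG-run chain run =
    fold (λ T T′ → Reached T → Reached T′) (λ s rest → rest ∘′ preserved s) id
         run (inj₁ chain)
    where
    Reached : Tree G → Set
    Reached T = IsChain T ⊎ IsLMGResult T
    preserved : ∀ {T T′} → LMGStep G budget T T′ → Reached T → Reached T′
    preserved s (inj₁ chain)  = inj₂ (chain-step chain s)
    preserved s (inj₂ result) = contradiction s (LMGResult-stuck result)

  LMGOutput⇒v₁-keeps-delta : ∀ {T} → LMGOutput G budget T → parent T v₁ ≡ just e₀₁
  LMGOutput⇒v₁-keeps-delta (_ , minimal , run , _) with LMG-run (minimal⇒chain minimal) run
  ... | inj₁ chain  = IsChain.v₁-delta chain
  ... | inj₂ result = IsLMGResult.v₁-delta result

  LMGOutput-retrieval : ∀ {T C} → LMGOutput G budget T → TotalRetrieval (treeSolution T) C →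
    suc k ℕ.≤ C
  LMGOutput-retrieval output (R , retrieval , refl)
    with unmaterialized-RPath-edge (cong is-nothing (LMGOutput⇒v₁-keeps-delta output))
                                   (proj₁ (retrieval v₁))
  ... | e , tgt≡v₁ , e≤R with Fin.suc-injective tgt≡v₁
  ... | refl = ℕ.≤-trans e≤R (≤-∑ R v₁)

theorem1 : (α : ℚ) → 1ℚ ≤ α →
    ∃ λ (G : VersionGraph) → ∃ λ (Sb : ℕ) →
      IsDirectedPath G × SingleWeight G × TriangleInequality G ×
      ∃ λ (opt : ℕ) → IsOptimum G Sb opt × 0 Data.Nat.< opt ×
        (∃ λ (T : Tree G) → LMGOutput G Sb T) ×
        (∀ (T : Tree G) (C : ℕ) → LMGOutput G Sb T → TotalRetrieval (treeSolution T) C →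
           α * (+ opt / 1) < + C / 1)
theorem1 α _ =
  G , budget , (2 , _ , _ , _ , refl) , (λ _ → refl) , triangle ,
  1 , optimum , z<s , (_ , LMG-output) ,
  λ T C output total → subst (_< + C / 1) (sym (*-identityʳ α))
                             (∣↥p∣<m⇒p<m/1 α (LMGOutput-retrieval output total))
  where open Gadget ℤ.∣ ↥ α ∣
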